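{- Let $\pi=\pi_1\pi_2\cdots\pi_n\in\mathfrak{S}_n$ and assume that $\pi$ has an inversion $\pi_i\pi_j$ (so $i<j$ and $\pi_i>\pi_j$) which avoids the patterns $312$ and $231$ in $\pi$. Then the pair $(\pi_i,\pi_j)$ is $1/2$-balanced in $P_\pi$, i.e. $\mathbb{P}(\pi_i\prec\pi_j)=1/2$ in $P_\pi$.
   Context: For $\pi=\pi_1\cdots\pi_n\in\mathfrak{S}_n$ (one-line notation), $P_\pi$ is the poset on $\{1,\dots,n\}$ obtained by intersecting the linear order given by $\pi$ with the natural order: $a\le_{P_\pi} b$ iff $a\le b$ as integers and $a$ appears weakly to the left of $b$ in $\pi$. A copy of a pattern $\sigma\in\mathfrak{S}_k$ in $\pi$ is a subsequence of $\pi$ whose entries are in the same relative order as those of $\sigma$. A subsequence $\pi'$ of $\pi$ is contained in a copy of $\sigma$ if some copy of $\sigma$ in $\pi$ uses every element of $\pi'$; otherwise $\pi'$ avoids $\sigma$ (in $\pi$). An inversion of $\pi$ is a copy $\pi_i\pi_j$ of the pattern $21$. For distinct $x,y$ in a finite poset $P$, $\mathbb{P}(x\prec y)$ is the proportion of linear extensions of $P$ (total orders compatible with the partial order) in which $x$ comes before $y$; $(x,y)$ is $1/2$-balanced if $\mathbb{P}(x\prec y)=1/2$. -}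

module Defs where

open import Data.Nat as ℕ using (ℕ; zero; suc)
open import Data.Fin using (Fin; toℕ; _≤_; _<_)
open import Data.Fin.Properties using (all?; _≤?_; _≟_)
open import Data.Fin.Permutation using (Permutation′; _⟨$⟩ʳ_; _⟨$⟩ˡ_)
open import Data.Vec using (Vec; []; _∷_; lookup)
open import Data.List using (List; [_]; map; concatMap; allFin; filter; length)
open import Data.Product using (_×_; ∃; _,_)
open import Data.Sum using (_⊎_)
open import Relation.Binary.PropositionalEquality using (_≡_)
open import Relation.Nullary using (Dec; ¬_)
open import Relation.Nullary.Decidable using (_×-dec_; _→-dec_)

-- Conventions: positions and values are 0-based (Fin n) instead of 1-based.
-- A permutation π ∈ 𝔖ₙ is a bijection Fin n ↔ Fin n; π ⟨$⟩ʳ i is the entry πᵢ,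
-- and π ⟨$⟩ˡ a is the position of the value a in the one-line notation.

_≤[_]_ : ∀ {n} → Fin n → Permutation′ n → Fin n → Set
a ≤[ π ] b = (a ≤ b) × ((π ⟨$⟩ˡ a) ≤ (π ⟨$⟩ˡ b))

-- A linear extension of P_π, encoded by its rank vector: σ assigns to each
-- element a its position (lookup σ a) in the total order.  σ must be injective
-- (hence a bijection of Fin n) and order preserving.
IsLinExt : ∀ {n} → Permutation′ n → Vec (Fin n) n → Set
IsLinExt {n} π σ =
  (∀ a b → lookup σ a ≡ lookup σ b → a ≡ b) ×
  (∀ a b → a ≤[ π ] b → lookup σ a ≤ lookup σ b)

isLinExt? : ∀ {n} (π : Permutation′ n) (σ : Vec (Fin n) n) → Dec (IsLinExt π σ)
isLinExt? π σ =
  all? (λ a → all? (λ b → (lookup σ a ≟ lookup σ b) →-dec (a ≟ b)))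
  ×-dec
  all? (λ a → all? (λ b → ((a ≤? b) ×-dec ((π ⟨$⟩ˡ a) ≤? (π ⟨$⟩ˡ b)))
                             →-dec (lookup σ a ≤? lookup σ b)))

allVecs : ∀ m k → List (Vec (Fin m) k)
allVecs m zero = [ [] ]
allVecs m (suc k) = concatMap (λ x → map (x ∷_) (allVecs m k)) (allFin m)

linExts : ∀ {n} → Permutation′ n → List (Vec (Fin n) n)
linExts {n} π = filter (isLinExt? π) (allVecs n n)

numLinExt : ∀ {n} → Permutation′ n → ℕ
numLinExt π = length (linExts π)

numBefore : ∀ {n} → Permutation′ n → Fin n → Fin n → ℕ
numBefore π x y = length (filter (λ σ → lookup σ x <? lookup σ y) (linExts π))
  where open import Data.Fin.Properties using (_<?_)

-- Patterns σ ∈ 𝔖ₖ given in one-line notation as vectors of naturals.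
-- A copy of σ in π: strictly increasing positions f with the entries
-- π(f 0), …, π(f (k-1)) in the same relative order as σ.
IsCopy : ∀ {n k} → Permutation′ n → Vec ℕ k → (Fin k → Fin n) → Set
IsCopy {n} {k} π σ f =
  (∀ a b → a < b → f a < f b) ×
  (∀ a b → (lookup σ a ℕ.< lookup σ b → (π ⟨$⟩ʳ f a) < (π ⟨$⟩ʳ f b)) ×
           ((π ⟨$⟩ʳ f a) < (π ⟨$⟩ʳ f b) → lookup σ a ℕ.< lookup σ b))

PairInCopy : ∀ {n k} → Permutation′ n → Vec ℕ k → Fin n → Fin n → Set
PairInCopy {n} {k} π σ i j =
  ∃ λ (f : Fin k → Fin n) → IsCopy π σ f × (∃ λ a → f a ≡ i) × (∃ λ b → f b ≡ j)

PairAvoids : ∀ {n k} → Permutation′ n → Vec ℕ k → Fin n → Fin n → Set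
PairAvoids π σ i j = ¬ PairInCopy π σ i j

p312 : Vec ℕ 3
p312 = 3 ∷ 1 ∷ 2 ∷ []

p231 : Vec ℕ 3
p231 = 2 ∷ 3 ∷ 1 ∷ []

module Submission where

-- Write x = πᵢ and y = πⱼ, so y < x.  Avoiding 312 and 231 forces the values
-- strictly between y and x to be exactly the entries at positions strictly
-- between i and j.  Consequently x and y are incomparable in P_π and every other
-- element is comparable to x exactly when it is comparable to y, in the same
-- direction; so the transposition of x and y is an automorphism of P_π.
-- Composing with it exchanges the linear extensions with x before y and those
-- with y before x, which therefore make up half of all linear extensions each.

open import Defs
open import Data.Nat as ℕ using (ℕ; zero; suc; _*_; _+_; z≤n; s≤s)
import Data.Nat.Properties as ℕP
open import Data.Fin using (Fin; _<_; _≤_; _≟_)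
open import Data.Fin.Patterns using (0F; 1F; 2F)
open import Data.Fin.Properties using (<-cmp; <-irrefl; ≤∧≢⇒<; all?)
open import Data.Fin.Permutation using (Permutation′; _⟨$⟩ʳ_; _⟨$⟩ˡ_; inverseˡ; inverseʳ)
open import Data.Fin.Permutation.Components using (transpose)
open import Data.Vec using (Vec; []; _∷_; lookup; tabulate)
import Data.Vec.Properties as Vecₚ
open import Data.List
  using (List; []; _∷_; _++_; map; concatMap; cartesianProductWith; allFin; filter; length)
open import Data.List.Properties using (length-map)
open import Data.List.Relation.Unary.Any using (here; there)
open import Data.List.Relation.Unary.All as All using (All; []; _∷_)
open import Data.List.Relation.Unary.All.Properties using (all-filter)
open import Data.List.Relation.Unary.AllPairs using ([]; _∷_)
open import Data.List.Relation.Unary.Unique.Propositional using (Unique)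
import Data.List.Relation.Unary.Unique.Propositional.Properties as Uniqueₚ
open import Data.List.Membership.Propositional using (_∈_)
open import Data.List.Membership.Propositional.Properties
  using (∈-map⁻; ∈-filter⁺; ∈-filter⁻; ∈-allFin; ∈-cartesianProductWith⁺)
open import Data.Product using (_×_; _,_; proj₁; proj₂)
open import Data.Sum using (_⊎_; inj₁; inj₂)
open import Data.Empty using (⊥-elim)
open import Data.Unit using (tt)
open import Function using (_∘_)
open import Relation.Binary using (tri<; tri≈; tri>)
open import Relation.Binary.PropositionalEquality
open import Relation.Nullary using (Dec; ¬_; yes; no)
open import Relation.Nullary.Decidable using (toWitness; _→-dec_; dec-true; dec-false)
open import Relation.Unary using (Decidable)

module _ {A : Set} where

  remove : ∀ {x : A} {ys} → x ∈ ys → List A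
  remove {ys = _ ∷ ys} (here _)  = ys
  remove {ys = y ∷ _}  (there p) = y ∷ remove p

  length-remove : ∀ {x : A} {ys} (p : x ∈ ys) → length ys ≡ suc (length (remove p))
  length-remove (here _)  = refl
  length-remove (there p) = cong suc (length-remove p)

  ∈-remove : ∀ {x z : A} {ys} (p : x ∈ ys) → z ∈ ys → z ≡ x ⊎ z ∈ remove p
  ∈-remove (here x≡y) (here z≡y) = inj₁ (trans z≡y (sym x≡y))
  ∈-remove (here _)   (there q)  = inj₂ q
  ∈-remove (there p)  (here z≡y) = inj₂ (here z≡y)
  ∈-remove (there p)  (there q)  with ∈-remove p q
  ... | inj₁ z≡x = inj₁ z≡x
  ... | inj₂ r   = inj₂ (there r)

  Unique-⊆⇒length-≤ : ∀ {xs ys : List A} →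
    Unique xs → (∀ {z} → z ∈ xs → z ∈ ys) → length xs ℕ.≤ length ys
  Unique-⊆⇒length-≤ {[]}     _          _   = z≤n
  Unique-⊆⇒length-≤ {x ∷ xs} {ys} (x∉xs ∷ u) xs⊆ys =
    subst (suc (length xs) ℕ.≤_) (sym (length-remove x∈ys))
      (s≤s (Unique-⊆⇒length-≤ u xs⊆ys-x))
    where
    x∈ys : x ∈ ys
    x∈ys = xs⊆ys (here refl)
    xs⊆ys-x : ∀ {z} → z ∈ xs → z ∈ remove x∈ys
    xs⊆ys-x z∈xs with ∈-remove x∈ys (xs⊆ys (there z∈xs))
    ... | inj₁ z≡x = ⊥-elim (All.lookup x∉xs z∈xs (sym z≡x))
    ... | inj₂ r   = r

  length-filter-≤-by-injection :
    ∀ {P Q : A → Set} (P? : Decidable P) (Q? : Decidable Q) {l : List A} → Unique l →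
    (g : A → A) → (∀ {a b} → g a ≡ g b → a ≡ b) →
    (∀ {a} → a ∈ l → P a → g a ∈ l × Q (g a)) →
    length (filter P? l) ℕ.≤ length (filter Q? l)
  length-filter-≤-by-injection P? Q? {l} u g g-inj g-maps =
    subst (ℕ._≤ length (filter Q? l)) (length-map g (filter P? l))
      (Unique-⊆⇒length-≤ (Uniqueₚ.map⁺ g-inj (Uniqueₚ.filter⁺ P? u)) image⊆)
    where
    image⊆ : ∀ {z} → z ∈ map g (filter P? l) → z ∈ filter Q? l
    image⊆ z∈ with ∈-map⁻ g z∈
    ... | a , a∈ , refl with ∈-filter⁻ P? a∈
    ...   | a∈l , Pa = let (ga∈l , Qga) = g-maps a∈l Pa in ∈-filter⁺ Q? ga∈l Qga

  length-filter-+-complementary :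
    ∀ {P Q : A → Set} (P? : Decidable P) (Q? : Decidable Q) (l : List A) →
    All (λ a → (P a ⊎ Q a) × ¬ (P a × Q a)) l →
    length (filter P? l) + length (filter Q? l) ≡ length l
  length-filter-+-complementary P? Q? [] [] = refl
  length-filter-+-complementary P? Q? (a ∷ l) ((P⊎Q , ¬P×Q) ∷ h) with P? a | Q? a
  ... | yes p  | yes q  = ⊥-elim (¬P×Q (p , q))
  ... | yes _  | no _   = cong suc (length-filter-+-complementary P? Q? l h)
  ... | no _   | yes _  = trans (ℕP.+-suc _ _) (cong suc (length-filter-+-complementary P? Q? l h))
  ... | no ¬p  | no ¬q  with P⊎Q
  ...   | inj₁ p = ⊥-elim (¬p p)
  ...   | inj₂ q = ⊥-elim (¬q q)

concatMap-map≡cartesianProductWith : ∀ {A B C : Set} (f : A → B → C) xs ys →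
  concatMap (λ x → map (f x) ys) xs ≡ cartesianProductWith f xs ys
concatMap-map≡cartesianProductWith f []       ys = refl
concatMap-map≡cartesianProductWith f (x ∷ xs) ys =
  cong (map (f x) ys ++_) (concatMap-map≡cartesianProductWith f xs ys)

allVecs-suc : ∀ m k → allVecs m (suc k) ≡ cartesianProductWith _∷_ (allFin m) (allVecs m k)
allVecs-suc m k = concatMap-map≡cartesianProductWith _∷_ (allFin m) (allVecs m k)

∈-allVecs : ∀ {m k} (v : Vec (Fin m) k) → v ∈ allVecs m k
∈-allVecs []                = here refl
∈-allVecs {m} {suc k} (a ∷ v) =
  subst ((a ∷ v) ∈_) (sym (allVecs-suc m k))
    (∈-cartesianProductWith⁺ _∷_ (∈-allFin a) (∈-allVecs v))

allVecs-unique : ∀ m k → Unique (allVecs m k)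
allVecs-unique m zero    = [] ∷ []
allVecs-unique m (suc k) = subst Unique (sym (allVecs-suc m k))
  (Uniqueₚ.cartesianProductWith⁺ _∷_ Vecₚ.∷-injective
    (Uniqueₚ.allFin⁺ m) (allVecs-unique m k))

data Position {n} (x y : Fin n) : Fin n → Set where
  at-x      : Position x y x
  at-y      : Position x y y
  elsewhere : ∀ {a} → a ≢ x → a ≢ y → Position x y a

position : ∀ {n} (x y a : Fin n) → Position x y a
position x y a with a ≟ x | a ≟ y
... | yes refl | _        = at-x
... | no _     | yes refl = at-y
... | no a≢x   | no a≢y   = elsewhere a≢x a≢y

transpose-matchˡ : ∀ {n} (i j : Fin n) → transpose i j i ≡ j
transpose-matchˡ i j rewrite dec-true (i ≟ i) refl = refl

transpose-matchʳ : ∀ {n} (i j : Fin n) → transpose i j j ≡ i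
transpose-matchʳ i j with i ≟ j
... | yes refl = transpose-matchˡ i i
... | no i≢j rewrite dec-false (j ≟ i) (i≢j ∘ sym) | dec-true (j ≟ j) refl = refl

transpose-mismatch : ∀ {n} {i j k : Fin n} → k ≢ i → k ≢ j → transpose i j k ≡ k
transpose-mismatch {i = i} {j} {k} k≢i k≢j
  rewrite dec-false (k ≟ i) k≢i | dec-false (k ≟ j) k≢j = refl

transpose-involutive : ∀ {n} (x y a : Fin n) → transpose x y (transpose x y a) ≡ a
transpose-involutive x y a with position x y a
... | at-x = trans (cong (transpose x y) (transpose-matchˡ x y)) (transpose-matchʳ x y)
... | at-y = trans (cong (transpose x y) (transpose-matchʳ x y)) (transpose-matchˡ x y)
... | elsewhere a≢x a≢y =
  trans (cong (transpose x y) (transpose-mismatch a≢x a≢y)) (transpose-mismatch a≢x a≢y)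

record Twins {n} (_≼_ : Fin n → Fin n → Set) (x y : Fin n) : Set where
  field
    below-x⇒below-y : ∀ {a} → a ≢ x → a ≢ y → a ≼ x → a ≼ y
    below-y⇒below-x : ∀ {a} → a ≢ x → a ≢ y → a ≼ y → a ≼ x
    above-x⇒above-y : ∀ {b} → b ≢ x → b ≢ y → x ≼ b → y ≼ b
    above-y⇒above-x : ∀ {b} → b ≢ x → b ≢ y → y ≼ b → x ≼ b

transpose-preserves-twins : ∀ {n} {_≼_ : Fin n → Fin n → Set} {x y : Fin n} →
  (∀ {a} → a ≼ a) → Twins _≼_ x y → ¬ (x ≼ y) → ¬ (y ≼ x) →
  ∀ {a b} → a ≼ b → transpose x y a ≼ transpose x y b
transpose-preserves-twins {x = x} {y} ≼-refl twins x⋠y y⋠x {a} {b} a≼b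
  with position x y a | position x y b
... | at-x | at-x rewrite transpose-matchˡ x y = ≼-refl
... | at-y | at-y rewrite transpose-matchʳ x y = ≼-refl
... | at-x | at-y = ⊥-elim (x⋠y a≼b)
... | at-y | at-x = ⊥-elim (y⋠x a≼b)
... | at-x | elsewhere b≢x b≢y rewrite transpose-matchˡ x y | transpose-mismatch b≢x b≢y =
  Twins.above-x⇒above-y twins b≢x b≢y a≼b
... | at-y | elsewhere b≢x b≢y rewrite transpose-matchʳ x y | transpose-mismatch b≢x b≢y =
  Twins.above-y⇒above-x twins b≢x b≢y a≼b
... | elsewhere a≢x a≢y | at-x rewrite transpose-matchˡ x y | transpose-mismatch a≢x a≢y =
  Twins.below-x⇒below-y twins a≢x a≢y a≼b
... | elsewhere a≢x a≢y | at-y rewrite transpose-matchʳ x y | transpose-mismatch a≢x a≢y =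
  Twins.below-y⇒below-x twins a≢x a≢y a≼b
... | elsewhere a≢x a≢y | elsewhere b≢x b≢y
  rewrite transpose-mismatch a≢x a≢y | transpose-mismatch b≢x b≢y = a≼b

module _ {n} (π : Permutation′ n) where

  IsAutomorphism : (Fin n → Fin n) → Set
  IsAutomorphism τ = ∀ {a b} → a ≤[ π ] b → τ a ≤[ π ] τ b

  ≤[]-refl : ∀ {a} → a ≤[ π ] a
  ≤[]-refl = ℕP.≤-refl , ℕP.≤-refl

  linExts-unique : Unique (linExts π)
  linExts-unique = Uniqueₚ.filter⁺ (isLinExt? π) (allVecs-unique n n)

  ∈-linExts⁺ : ∀ {σ} → IsLinExt π σ → σ ∈ linExts π
  ∈-linExts⁺ {σ} = ∈-filter⁺ (isLinExt? π) (∈-allVecs σ)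

  ∈-linExts⁻ : ∀ {σ} → σ ∈ linExts π → IsLinExt π σ
  ∈-linExts⁻ {σ} = proj₂ ∘ ∈-filter⁻ (isLinExt? π) {σ} {allVecs n n}

  precompose : (Fin n → Fin n) → Vec (Fin n) n → Vec (Fin n) n
  precompose τ σ = tabulate (lookup σ ∘ τ)

  lookup-precompose : ∀ τ σ a → lookup (precompose τ σ) a ≡ lookup σ (τ a)
  lookup-precompose τ σ = Vecₚ.lookup∘tabulate (lookup σ ∘ τ)

  module _ {τ : Fin n → Fin n}
    (τ-involutive : ∀ a → τ (τ a) ≡ a) (τ-automorphism : IsAutomorphism τ) where

    precompose-involutive : ∀ σ → precompose τ (precompose τ σ) ≡ σ
    precompose-involutive σ = trans
      (Vecₚ.tabulate-cong λ a →
        trans (lookup-precompose τ σ (τ a)) (cong (lookup σ) (τ-involutive a)))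
      (Vecₚ.tabulate∘lookup σ)

    precompose-injective : ∀ {σ σ′} → precompose τ σ ≡ precompose τ σ′ → σ ≡ σ′
    precompose-injective {σ} {σ′} eq =
      trans (sym (precompose-involutive σ))
            (trans (cong (precompose τ) eq) (precompose-involutive σ′))

    IsLinExt-precompose : ∀ {σ} → IsLinExt π σ → IsLinExt π (precompose τ σ)
    IsLinExt-precompose {σ} (σ-injective , σ-monotone) = injective , monotone
      where
      injective : ∀ a b → lookup (precompose τ σ) a ≡ lookup (precompose τ σ) b → a ≡ b
      injective a b eq = begin
        a        ≡⟨ sym (τ-involutive a) ⟩
        τ (τ a)  ≡⟨ cong τ (σ-injective (τ a) (τ b)
                      (trans (sym (lookup-precompose τ σ a)) (trans eq (lookup-precompose τ σ b)))) ⟩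
        τ (τ b)  ≡⟨ τ-involutive b ⟩
        b        ∎
        where open ≡-Reasoning
      monotone : ∀ a b → a ≤[ π ] b → lookup (precompose τ σ) a ≤ lookup (precompose τ σ) b
      monotone a b a≤b =
        subst₂ _≤_ (sym (lookup-precompose τ σ a)) (sym (lookup-precompose τ σ b))
          (σ-monotone (τ a) (τ b) (τ-automorphism a≤b))

    numBefore-≤-swapped : ∀ {u v} → τ u ≡ v → τ v ≡ u →
      numBefore π u v ℕ.≤ numBefore π v u
    numBefore-≤-swapped {u} {v} τu≡v τv≡u =
      length-filter-≤-by-injection _ _ linExts-unique (precompose τ) precompose-injective maps
      where
      maps : ∀ {σ} → σ ∈ linExts π → lookup σ u < lookup σ v →
             precompose τ σ ∈ linExts π × lookup (precompose τ σ) v < lookup (precompose τ σ) u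
      maps {σ} σ∈ σu<σv =
        ∈-linExts⁺ (IsLinExt-precompose {σ} (∈-linExts⁻ σ∈)) ,
        subst₂ _<_ (trans (cong (lookup σ) (sym τv≡u)) (sym (lookup-precompose τ σ v)))
                   (trans (cong (lookup σ) (sym τu≡v)) (sym (lookup-precompose τ σ u))) σu<σv

    numBefore-swapped : ∀ {u v} → τ u ≡ v → τ v ≡ u → numBefore π u v ≡ numBefore π v u
    numBefore-swapped τu≡v τv≡u =
      ℕP.≤-antisym (numBefore-≤-swapped τu≡v τv≡u) (numBefore-≤-swapped τv≡u τu≡v)

  numBefore-+-numBefore : ∀ {u v} → u ≢ v → numBefore π u v + numBefore π v u ≡ numLinExt π
  numBefore-+-numBefore {u} {v} u≢v = length-filter-+-complementary _ _ (linExts π)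
    (All.map (λ {σ} → comparable {σ}) (all-filter (isLinExt? π) (allVecs n n)))
    where
    comparable : ∀ {σ} → IsLinExt π σ →
      (lookup σ u < lookup σ v ⊎ lookup σ v < lookup σ u) ×
      ¬ (lookup σ u < lookup σ v × lookup σ v < lookup σ u)
    comparable {σ} (σ-injective , _) with <-cmp (lookup σ u) (lookup σ v)
    ... | tri< lt _ _ = inj₁ lt , λ (lt , gt) → ℕP.<-asym lt gt
    ... | tri≈ _ eq _ = ⊥-elim (u≢v (σ-injective u v eq))
    ... | tri> _ _ gt = inj₂ gt , λ (lt , gt) → ℕP.<-asym lt gt

triple : ∀ {n} → Fin n → Fin n → Fin n → Fin 3 → Fin n
triple a b c 0F = a
triple a b c 1F = b
triple a b c 2F = c

triple-increasing : ∀ {n} {a b c : Fin n} → a < b → b < c →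
  ∀ u v → u < v → triple a b c u < triple a b c v
triple-increasing a<b b<c 0F 1F _ = a<b
triple-increasing a<b b<c 0F 2F _ = ℕP.<-trans a<b b<c
triple-increasing a<b b<c 1F 2F _ = b<c
triple-increasing a<b b<c 0F 0F ()
triple-increasing a<b b<c 1F 0F ()
triple-increasing a<b b<c 1F 1F (s≤s ())
triple-increasing a<b b<c 2F 0F ()
triple-increasing a<b b<c 2F 1F (s≤s ())
triple-increasing a<b b<c 2F 2F (s≤s (s≤s ()))

PatternInjective : ∀ {k} → Vec ℕ k → Set
PatternInjective σ = ∀ u v → lookup σ u ≡ lookup σ v → u ≡ v

patternInjective? : ∀ {k} (σ : Vec ℕ k) → Dec (PatternInjective σ)
patternInjective? σ =
  all? λ u → all? λ v → (lookup σ u ℕ.≟ lookup σ v) →-dec (u ≟ v)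

module _ {n} (π : Permutation′ n) where

  order-preserving⇒IsCopy : ∀ {k} (σ : Vec ℕ k) {f : Fin k → Fin n} → PatternInjective σ →
    (∀ u v → u < v → f u < f v) →
    (∀ u v → lookup σ u ℕ.< lookup σ v → π ⟨$⟩ʳ f u < π ⟨$⟩ʳ f v) →
    IsCopy π σ f
  order-preserving⇒IsCopy σ {f} σ-injective f-increasing preserves =
    f-increasing , λ u v → preserves u v , reflects u v
    where
    reflects : ∀ u v → π ⟨$⟩ʳ f u < π ⟨$⟩ʳ f v → lookup σ u ℕ.< lookup σ v
    reflects u v fu<fv with ℕP.<-cmp (lookup σ u) (lookup σ v)
    ... | tri< lt _ _ = lt
    ... | tri≈ _ eq _ = ⊥-elim (<-irrefl (cong (λ w → π ⟨$⟩ʳ f w) (σ-injective u v eq)) fu<fv)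
    ... | tri> _ _ gt = ⊥-elim (ℕP.<-asym fu<fv (preserves v u gt))

  private
    ent : Fin n → Fin n
    ent = π ⟨$⟩ʳ_

  copy312 : ∀ {a b c} → a < b → b < c → ent b < ent c → ent c < ent a →
    IsCopy π p312 (triple a b c)
  copy312 {a} {b} {c} a<b b<c vb<vc vc<va = order-preserving⇒IsCopy p312
    (toWitness {a? = patternInjective? p312} tt) (triple-increasing a<b b<c) preserves
    where
    preserves : ∀ u v → lookup p312 u ℕ.< lookup p312 v →
      ent (triple a b c u) < ent (triple a b c v)
    preserves 1F 2F _ = vb<vc
    preserves 1F 0F _ = ℕP.<-trans vb<vc vc<va
    preserves 2F 0F _ = vc<va
    preserves 0F 0F (s≤s (s≤s (s≤s ())))
    preserves 0F 1F (s≤s ())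
    preserves 0F 2F (s≤s (s≤s ()))
    preserves 1F 1F (s≤s ())
    preserves 2F 1F (s≤s ())
    preserves 2F 2F (s≤s (s≤s ()))

  copy231 : ∀ {a b c} → a < b → b < c → ent c < ent a → ent a < ent b →
    IsCopy π p231 (triple a b c)
  copy231 {a} {b} {c} a<b b<c vc<va va<vb = order-preserving⇒IsCopy p231
    (toWitness {a? = patternInjective? p231} tt) (triple-increasing a<b b<c) preserves
    where
    preserves : ∀ u v → lookup p231 u ℕ.< lookup p231 v →
      ent (triple a b c u) < ent (triple a b c v)
    preserves 0F 1F _ = va<vb
    preserves 2F 0F _ = vc<va
    preserves 2F 1F _ = ℕP.<-trans vc<va va<vb
    preserves 0F 0F (s≤s (s≤s ()))
    preserves 0F 2F (s≤s ())
    preserves 1F 0F (s≤s (s≤s ()))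
    preserves 1F 1F (s≤s (s≤s (s≤s ())))
    preserves 1F 2F (s≤s ())
    preserves 2F 2F (s≤s ())

module AvoidingInversion {n} (π : Permutation′ n) {i j : Fin n} (i<j : i < j)
  (inversion : π ⟨$⟩ʳ j < π ⟨$⟩ʳ i)
  (avoids312 : PairAvoids π p312 i j) (avoids231 : PairAvoids π p231 i j) where

  private
    ent pos : Fin n → Fin n
    ent = π ⟨$⟩ʳ_
    pos = π ⟨$⟩ˡ_

    ent-pos : ∀ b → ent (pos b) ≡ b
    ent-pos b = inverseʳ π

    ent-injective : ∀ {p q} → ent p ≡ ent q → p ≡ q
    ent-injective e = trans (sym (inverseˡ π)) (trans (cong pos e) (inverseˡ π))

  x y : Fin n
  x = ent i
  y = ent j

  private
    pos-x : pos x ≡ i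
    pos-x = inverseˡ π

    pos-y : pos y ≡ j
    pos-y = inverseˡ π

    pos-≢ : ∀ {b q} → b ≢ ent q → pos b ≢ q
    pos-≢ {b} b≢ pb≡q = b≢ (trans (sym (ent-pos b)) (cong ent pb≡q))

  value-between⇒position-between : ∀ {b} → y < b → b < x → i < pos b × pos b < j
  value-between⇒position-between {b} y<b b<x = after-i , before-j
    where
    y<v : y < ent (pos b)
    y<v = subst (y <_) (sym (ent-pos b)) y<b
    v<x : ent (pos b) < x
    v<x = subst (_< x) (sym (ent-pos b)) b<x
    after-i : i < pos b
    after-i with <-cmp i (pos b)
    ... | tri< i<pb _ _ = i<pb
    ... | tri≈ _ i≡pb _ = ⊥-elim (<-irrefl (cong ent (sym i≡pb)) v<x)
    ... | tri> _ _ pb<i = ⊥-elim (avoids231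
          (triple (pos b) i j , copy231 π pb<i i<j y<v v<x , (1F , refl) , (2F , refl)))
    before-j : pos b < j
    before-j with <-cmp (pos b) j
    ... | tri< pb<j _ _ = pb<j
    ... | tri≈ _ pb≡j _ = ⊥-elim (<-irrefl (cong ent (sym pb≡j)) y<v)
    ... | tri> _ _ j<pb = ⊥-elim (avoids312
          (triple i j (pos b) , copy312 π i<j j<pb y<v v<x , (0F , refl) , (1F , refl)))

  position-between⇒value-between : ∀ {b} → i < pos b → pos b < j → y < b × b < x
  position-between⇒value-between {b} i<pb pb<j =
    subst (y <_) (ent-pos b) above-y , subst (_< x) (ent-pos b) below-x
    where
    above-y : y < ent (pos b)
    above-y with <-cmp y (ent (pos b))
    ... | tri< y<v _ _ = y<v
    ... | tri≈ _ y≡v _ = ⊥-elim (<-irrefl (sym (ent-injective y≡v)) pb<j)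
    ... | tri> _ _ v<y = ⊥-elim (avoids312
          (triple i (pos b) j , copy312 π i<pb pb<j v<y inversion , (0F , refl) , (2F , refl)))
    below-x : ent (pos b) < x
    below-x with <-cmp (ent (pos b)) x
    ... | tri< v<x _ _ = v<x
    ... | tri≈ _ v≡x _ = ⊥-elim (<-irrefl (sym (ent-injective v≡x)) i<pb)
    ... | tri> _ _ x<v = ⊥-elim (avoids231
          (triple i (pos b) j , copy231 π i<pb pb<j inversion x<v , (0F , refl) , (2F , refl)))

  twins : Twins _≤[ π ]_ x y
  twins = record
    { below-x⇒below-y = below-x⇒below-y
    ; below-y⇒below-x = below-y⇒below-x
    ; above-x⇒above-y = above-x⇒above-y
    ; above-y⇒above-x = above-y⇒above-x
    }
    where
    below-x⇒below-y : ∀ {a} → a ≢ x → a ≢ y → a ≤[ π ] x → a ≤[ π ] y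
    below-x⇒below-y {a} a≢x _ (a≤x , pa≤px) =
      a≤y , subst (pos a ≤_) (sym pos-y) (ℕP.<⇒≤ (ℕP.≤-<-trans pa≤i i<j))
      where
      pa≤i : pos a ≤ i
      pa≤i = subst (pos a ≤_) pos-x pa≤px
      a≤y : a ≤ y
      a≤y = ℕP.≮⇒≥ λ y<a →
        ℕP.<⇒≱ (proj₁ (value-between⇒position-between y<a (≤∧≢⇒< a≤x a≢x))) pa≤i

    below-y⇒below-x : ∀ {a} → a ≢ x → a ≢ y → a ≤[ π ] y → a ≤[ π ] x
    below-y⇒below-x {a} _ a≢y (a≤y , pa≤py) =
      ℕP.<⇒≤ (ℕP.≤-<-trans a≤y inversion) , subst (pos a ≤_) (sym pos-x) pa≤i
      where
      pa≤j : pos a ≤ j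
      pa≤j = subst (pos a ≤_) pos-y pa≤py
      pa≤i : pos a ≤ i
      pa≤i = ℕP.≮⇒≥ λ i<pa →
        ℕP.<⇒≱ (proj₁ (position-between⇒value-between i<pa (≤∧≢⇒< pa≤j (pos-≢ a≢y)))) a≤y

    above-x⇒above-y : ∀ {b} → b ≢ x → b ≢ y → x ≤[ π ] b → y ≤[ π ] b
    above-x⇒above-y {b} b≢x _ (x≤b , px≤pb) =
      ℕP.<⇒≤ (ℕP.<-≤-trans inversion x≤b) , subst (_≤ pos b) (sym pos-y) j≤pb
      where
      i≤pb : i ≤ pos b
      i≤pb = subst (_≤ pos b) pos-x px≤pb
      j≤pb : j ≤ pos b
      j≤pb = ℕP.≮⇒≥ λ pb<j →
        ℕP.<⇒≱ (proj₂ (position-between⇒value-between (≤∧≢⇒< i≤pb (pos-≢ b≢x ∘ sym)) pb<j)) x≤b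

    above-y⇒above-x : ∀ {b} → b ≢ x → b ≢ y → y ≤[ π ] b → x ≤[ π ] b
    above-y⇒above-x {b} _ b≢y (y≤b , py≤pb) =
      x≤b , subst (_≤ pos b) (sym pos-x) (ℕP.<⇒≤ (ℕP.<-≤-trans i<j j≤pb))
      where
      j≤pb : j ≤ pos b
      j≤pb = subst (_≤ pos b) pos-y py≤pb
      x≤b : x ≤ b
      x≤b = ℕP.≮⇒≥ λ b<x →
        ℕP.<⇒≱ (proj₂ (value-between⇒position-between (≤∧≢⇒< y≤b (b≢y ∘ sym)) b<x)) j≤pb

  x≢y : x ≢ y
  x≢y x≡y = <-irrefl (sym x≡y) inversion

  transpose-automorphism : IsAutomorphism π (transpose x y)
  transpose-automorphism = transpose-preserves-twins (≤[]-refl π) twins x⋠y y⋠x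
    where
    x⋠y : ¬ (x ≤[ π ] y)
    x⋠y (x≤y , _) = ℕP.<⇒≱ inversion x≤y
    y⋠x : ¬ (y ≤[ π ] x)
    y⋠x (_ , py≤px) = ℕP.<⇒≱ i<j (subst₂ _≤_ pos-y pos-x py≤px)

proposition5p1 : (n : ℕ) (π : Permutation′ n) (i j : Fin n) →
    i < j → (π ⟨$⟩ʳ j) < (π ⟨$⟩ʳ i) →
    PairAvoids π p312 i j → PairAvoids π p231 i j →
    2 * numBefore π (π ⟨$⟩ʳ i) (π ⟨$⟩ʳ j) ≡ numLinExt π
proposition5p1 n π i j i<j inversion avoids312 avoids231 = begin
  2 * numBefore π x y                ≡⟨ cong (numBefore π x y +_) (ℕP.+-identityʳ _) ⟩
  numBefore π x y + numBefore π x y  ≡⟨ cong (numBefore π x y +_) swap-invariant ⟩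
  numBefore π x y + numBefore π y x  ≡⟨ numBefore-+-numBefore π x≢y ⟩
  numLinExt π                        ∎
  where
  open AvoidingInversion π i<j inversion avoids312 avoids231
  open ≡-Reasoning
  swap-invariant : numBefore π x y ≡ numBefore π y x
  swap-invariant = numBefore-swapped π (transpose-involutive x y) transpose-automorphism
    (transpose-matchˡ x y) (transpose-matchʳ x y)
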